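{- Let $p$ be a fixed odd prime, let $q\in\mathbb{C}_p$ with $|q-1|_p<1$, and let the $q$-Euler numbers $\widetilde{E}_{n,q}$ ($n\ge 0$) be defined by $$\frac{[2]_q}{qe^{t}+1}=\sum_{n=0}^{\infty}\widetilde{E}_{n,q}\frac{t^n}{n!},\qquad [2]_q=1+q.$$ Then for all natural numbers $m,k$, $$\sum_{j=0}^{\max\{k,m\}}\left[q\binom{k}{j}+(-1)^j\binom{m}{j}\right]\sum_{l=0}^{k+m-j}\binom{k+m-j}{l}\widetilde{E}_{k+m-j-l,q}\,\widetilde{E}_{l,q} =[2]_q\sum_{l=0}^{m}\binom{m}{l}(-1)^{m-l}\widetilde{E}_{l+k,q}.$$
   Context: $\mathbb{C}_p$ is the completion of an algebraic closure of $\mathbb{Q}_p$, and $|\cdot|_p$ is the $p$-adic absolute value with $|p|_p=1/p$. The generating function is a formal power series in $t$. Binomial coefficients $\binom{a}{j}$ with $j>a\ge0$ are $0$. Equivalently, $\widetilde{E}_{n,q}=\int_{\mathbb{Z}_p}y^n\,d\mu_{ -q}(y)$, where $\int_{\mathbb{Z}_p}f\,d\mu_{ -q}$ is Kim's fermionic $p$-adic $q$-integral. -}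

module Defs where

open import Level using (Level)
open import Data.Nat using (ℕ; zero; suc; _⊔_; _∸_) renaming (_+_ to _+ℕ_)
open import Data.Nat.Combinatorics using (_C_)
open import Algebra.Bundles using (CommutativeRing)

module _ {c ℓ : Level} (R : CommutativeRing c ℓ) where
  open CommutativeRing R

  ⟦_⟧ : ℕ → Carrier
  ⟦ zero ⟧  = 0#
  ⟦ suc n ⟧ = 1# + ⟦ n ⟧

  sgn : ℕ → Carrier
  sgn zero    = 1#
  sgn (suc n) = - (sgn n)

  Σ≤ : ℕ → (ℕ → Carrier) → Carrier
  Σ≤ zero    f = f 0
  Σ≤ (suc n) f = Σ≤ n f + f (suc n)

  [2] : Carrier → Carrier
  [2] q = 1# + q

  δ₀ : ℕ → Carrier
  δ₀ zero    = 1#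
  δ₀ (suc _) = 0#

  -- E is the sequence of q-Euler numbers: coefficient of t^n/n! in
  -- (q e^t + 1) · Σ E_n t^n/n!  equals that of [2]_q, i.e.
  --   q Σ_{i=0}^{n} C(n,i) E_i + E_n = [2]_q δ_{n,0}  for all n.
  IsQEuler : Carrier → (ℕ → Carrier) → Set ℓ
  IsQEuler q E = ∀ n →
    q * Σ≤ n (λ i → ⟦ n C i ⟧ * E i) + E n ≈ [2] q * δ₀ n

  LHS : Carrier → (ℕ → Carrier) → ℕ → ℕ → Carrier
  LHS q E k m = Σ≤ (k ⊔ m) λ j →
    (q * ⟦ k C j ⟧ + sgn j * ⟦ m C j ⟧) *
    Σ≤ ((k +ℕ m) ∸ j) (λ l → ⟦ ((k +ℕ m) ∸ j) C l ⟧ * E (((k +ℕ m) ∸ j) ∸ l) * E l)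

  RHS : Carrier → (ℕ → Carrier) → ℕ → ℕ → Carrier
  RHS q E k m = [2] q * Σ≤ m (λ l → ⟦ m C l ⟧ * sgn (m ∸ l) * E (l +ℕ k))

module Submission where

-- Write
-- T a n = Σ_i C(n,i) a_i for the binomial transform (multiplying an EGF by
-- e^t), a ⋆ b for the binomial convolution (product of EGFs) and
-- Δ^m a (k) = Σ_l C(m,l) (-1)^(m-l) a_(l+k) for the m-th forward difference.
-- The hypothesis reads q·T E + E = [2]_q·δ, and the proof has three steps:
--   (1) T(a ⋆ b) = (T a) ⋆ b, hence q·T(E⋆E) + E⋆E = ([2]_q δ) ⋆ E = [2]_q E;
--   (2) Δ^m (T a) (k) = Σ_j C(k,j) a_(j+m), by induction on m via Pascal's rule;
--   (3) reflecting the summation index, the left-hand side equals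
--       q·Σ_j C(k,j) F_(j+m) + Δ^m F (k) with F = E ⋆ E.
-- By (2) and linearity the left-hand side is Δ^m (q·T F + F) (k), which (1)
-- turns into [2]_q Δ^m E (k), the right-hand side.

open import Level using (Level)
open import Data.Nat using (ℕ)
open import Algebra.Bundles using (CommutativeRing)
open import Defs

module BinomialNat where
  open import Data.Nat.Base
  open import Data.Nat.Properties
  open import Data.Nat.Combinatorics
  open import Data.Nat.DivMod using (m/n*n≡m)
  open import Data.Nat.Solver using (module +-*-Solver)
  open +-*-Solver
  open import Relation.Binary.PropositionalEquality
  open ≡-Reasoning

  C*factorials : ∀ {n k} → k ≤ n → (n C k) * (k ! * (n ∸ k) !) ≡ n !
  C*factorials {n} {k} k≤n =
    trans (cong (_* (k ! * (n ∸ k) !)) (nCk≡n!/k![n-k]! k≤n))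
          (m/n*n≡m {{k !* (n ∸ k) !≢0}} (k![n∸k]!∣n! k≤n))

  -- Choosing l+t elements of k and then l of those is the same as choosing
  -- l elements of k and then t of the remaining k-l ones.
  choose-twice : ∀ k l t → l + t ≤ k →
    (k C (l + t)) * ((l + t) C l) ≡ (k C l) * ((k ∸ l) C t)
  choose-twice k l t l+t≤k =
    *-cancelʳ-≡ _ _ (l ! * t ! * (k ∸ (l + t)) !)
      {{m*n≢0 _ _ {{l !* t !≢0}} {{(k ∸ (l + t)) !≢0}}}}
      (trans via-l+t (sym via-l))
    where
    l≤l+t : l ≤ l + t
    l≤l+t = m≤m+n l t
    l≤k : l ≤ k
    l≤k = ≤-trans l≤l+t l+t≤k
    t≤k∸l : t ≤ k ∸ l
    t≤k∸l = subst (_≤ k ∸ l) (m+n∸m≡n l t) (∸-monoˡ-≤ l l+t≤k)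

    via-l+t : (k C (l + t)) * ((l + t) C l) * (l ! * t ! * (k ∸ (l + t)) !) ≡ k !
    via-l+t = begin
      (k C (l + t)) * ((l + t) C l) * (l ! * t ! * (k ∸ (l + t)) !)
        ≡⟨ solve 5 (λ x y a b c → x :* y :* (a :* b :* c) := x :* (y :* (a :* b)) :* c)
                   refl (k C (l + t)) ((l + t) C l) (l !) (t !) ((k ∸ (l + t)) !) ⟩
      (k C (l + t)) * (((l + t) C l) * (l ! * t !)) * (k ∸ (l + t)) !
        ≡⟨ cong (λ s → (k C (l + t)) * (((l + t) C l) * (l ! * s !)) * (k ∸ (l + t)) !)
                (sym (m+n∸m≡n l t)) ⟩
      (k C (l + t)) * (((l + t) C l) * (l ! * ((l + t) ∸ l) !)) * (k ∸ (l + t)) !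
        ≡⟨ cong (λ s → (k C (l + t)) * s * (k ∸ (l + t)) !) (C*factorials l≤l+t) ⟩
      (k C (l + t)) * (l + t) ! * (k ∸ (l + t)) !
        ≡⟨ *-assoc (k C (l + t)) ((l + t) !) ((k ∸ (l + t)) !) ⟩
      (k C (l + t)) * ((l + t) ! * (k ∸ (l + t)) !)
        ≡⟨ C*factorials l+t≤k ⟩
      k ! ∎

    via-l : (k C l) * ((k ∸ l) C t) * (l ! * t ! * (k ∸ (l + t)) !) ≡ k !
    via-l = begin
      (k C l) * ((k ∸ l) C t) * (l ! * t ! * (k ∸ (l + t)) !)
        ≡⟨ cong (λ s → (k C l) * ((k ∸ l) C t) * (l ! * t ! * s !)) (sym (∸-+-assoc k l t)) ⟩
      (k C l) * ((k ∸ l) C t) * (l ! * t ! * ((k ∸ l) ∸ t) !)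
        ≡⟨ solve 5 (λ x y a b c → x :* y :* (a :* b :* c) := x :* (a :* (y :* (b :* c))))
                   refl (k C l) ((k ∸ l) C t) (l !) (t !) (((k ∸ l) ∸ t) !) ⟩
      (k C l) * (l ! * (((k ∸ l) C t) * (t ! * ((k ∸ l) ∸ t) !)))
        ≡⟨ cong (λ s → (k C l) * (l ! * s)) (C*factorials t≤k∸l) ⟩
      (k C l) * (l ! * (k ∸ l) !)
        ≡⟨ C*factorials l≤k ⟩
      k ! ∎

  reflect-index : ∀ {n i} p → i ≤ n → (n + p) ∸ (n ∸ i) ≡ i + p
  reflect-index {n} {i} p i≤n =
    trans (+-∸-comm p (m∸n≤m n i)) (cong (_+ p) (m∸[m∸n]≡n i≤n))


module BinomialSums {c ℓ : Level} (R : CommutativeRing c ℓ) where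
  open import Data.Nat.Base using (zero; suc; _≤_; _<_; _≤′_; ≤′-refl; ≤′-step; s≤s; _∸_; _⊔_)
    renaming (_+_ to _+ℕ_; _*_ to _*ℕ_)
  import Data.Nat.Properties as ℕₚ
  open import Data.Nat.Combinatorics
    using (_C_; k>n⇒nCk≡0; nCk+nC[k+1]≡[n+1]C[k+1]; nCn≡1; nCk≡nC[n∸k])
  open import Relation.Binary.PropositionalEquality as ≡ using (_≡_)
  open import Function.Base using (_∘_)
  open BinomialNat using (choose-twice; reflect-index)

  open CommutativeRing R
  open import Relation.Binary.Reasoning.Setoid setoid
  open import Algebra.Properties.Ring ring using (-‿distribˡ-*; -‿distribʳ-*)
  open import Algebra.Properties.AbelianGroup +-abelianGroup using (⁻¹-∙-comm; xyx⁻¹≈y)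
  open import Algebra.Solver.Ring.NaturalCoefficients.Default commutativeSemiring
    using (solve; _:=_; _:+_; _:*_)

  Σ : ℕ → (ℕ → Carrier) → Carrier
  Σ = Σ≤ R

  ι : ℕ → Carrier
  ι = ⟦_⟧ R

  sg : ℕ → Carrier
  sg = sgn R

  δ : ℕ → Carrier
  δ = δ₀ R

  Σ-≡ : ∀ {n n′} f → n ≡ n′ → Σ n f ≈ Σ n′ f
  Σ-≡ f n≡n′ = reflexive (≡.cong (λ n → Σ n f) n≡n′)

  Σ-cong : ∀ n {f g} → (∀ i → i ≤ n → f i ≈ g i) → Σ n f ≈ Σ n g
  Σ-cong zero    f≈g = f≈g 0 ℕₚ.≤-refl
  Σ-cong (suc n) f≈g =
    +-cong (Σ-cong n (λ i i≤n → f≈g i (ℕₚ.m≤n⇒m≤1+n i≤n))) (f≈g (suc n) ℕₚ.≤-refl)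

  Σ-+ : ∀ n f g → Σ n (λ i → f i + g i) ≈ Σ n f + Σ n g
  Σ-+ zero    f g = refl
  Σ-+ (suc n) f g = begin
    Σ n (λ i → f i + g i) + (f (suc n) + g (suc n))
      ≈⟨ +-congʳ (Σ-+ n f g) ⟩
    (Σ n f + Σ n g) + (f (suc n) + g (suc n))
      ≈⟨ solve 4 (λ a b x y → (a :+ b) :+ (x :+ y) := (a :+ x) :+ (b :+ y))
               refl (Σ n f) (Σ n g) (f (suc n)) (g (suc n)) ⟩
    (Σ n f + f (suc n)) + (Σ n g + g (suc n)) ∎

  Σ-* : ∀ n a f → Σ n (λ i → a * f i) ≈ a * Σ n f
  Σ-* zero    a f = refl
  Σ-* (suc n) a f = trans (+-congʳ (Σ-* n a f)) (sym (distribˡ a (Σ n f) (f (suc n))))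

  Σ-neg : ∀ n f → Σ n (λ i → - f i) ≈ - Σ n f
  Σ-neg zero    f = refl
  Σ-neg (suc n) f = trans (+-congʳ (Σ-neg n f)) (⁻¹-∙-comm (Σ n f) (f (suc n)))

  Σ-shift : ∀ n f → Σ (suc n) f ≈ f 0 + Σ n (f ∘ suc)
  Σ-shift zero    f = refl
  Σ-shift (suc n) f = trans (+-congʳ (Σ-shift n f)) (+-assoc _ _ _)

  Σ-zero : ∀ n f → (∀ i → i ≤ n → f i ≈ 0#) → Σ n f ≈ 0#
  Σ-zero n f f≈0 = trans (Σ-cong n f≈0) (zero-sum n)
    where
    zero-sum : ∀ n → Σ n (λ _ → 0#) ≈ 0#
    zero-sum zero    = refl
    zero-sum (suc n) = trans (+-congʳ (zero-sum n)) (+-identityˡ 0#)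

  Σ-top : ∀ n f → (∀ i → i < n → f i ≈ 0#) → Σ n f ≈ f n
  Σ-top zero    f _   = refl
  Σ-top (suc n) f f≈0 =
    trans (+-congʳ (Σ-zero n f (λ i i≤n → f≈0 i (s≤s i≤n)))) (+-identityˡ _)

  Σ-ext : ∀ {n m} f → n ≤′ m → (∀ i → n < i → f i ≈ 0#) → Σ n f ≈ Σ m f
  Σ-ext f ≤′-refl          _   = refl
  Σ-ext f (≤′-step {m} n≤m) f≈0 =
    trans (sym (+-identityʳ _))
          (+-cong (Σ-ext f n≤m f≈0) (sym (f≈0 (suc m) (s≤s (ℕₚ.≤′⇒≤ n≤m)))))

  Σ-reflect : ∀ n f g → (∀ i → i ≤ n → f (n ∸ i) ≈ g i) → Σ n f ≈ Σ n g
  Σ-reflect n f g f∘reflect≈g = trans (reverse n f) (Σ-cong n f∘reflect≈g)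
    where
    reverse : ∀ n f → Σ n f ≈ Σ n (λ j → f (n ∸ j))
    reverse zero    f = refl
    reverse (suc n) f = begin
      Σ n f + f (suc n)                  ≈⟨ +-comm _ _ ⟩
      f (suc n) + Σ n f                  ≈⟨ +-congˡ (reverse n f) ⟩
      f (suc n) + Σ n (λ j → f (n ∸ j))  ≈⟨ Σ-shift n (λ j → f (suc n ∸ j)) ⟨
      Σ (suc n) (λ j → f (suc n ∸ j))    ∎

  Σ-triangle : ∀ n (g : ℕ → ℕ → Carrier) →
    Σ n (λ i → Σ i (g i)) ≈ Σ n (λ l → Σ (n ∸ l) (λ t → g (l +ℕ t) l))
  Σ-triangle zero    g = refl
  Σ-triangle (suc n) g = begin
    Σ n (λ i → Σ i (g i)) + (Σ n (g (suc n)) + g (suc n) (suc n))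
      ≈⟨ +-congʳ (Σ-triangle n g) ⟩
    Σ n column + (Σ n (g (suc n)) + g (suc n) (suc n))
      ≈⟨ +-assoc _ _ _ ⟨
    (Σ n column + Σ n (g (suc n))) + g (suc n) (suc n)
      ≈⟨ +-cong (trans (sym (Σ-+ n _ _)) (Σ-cong n longer-column)) (sym last-column) ⟩
    Σ n (λ l → Σ (suc n ∸ l) (λ t → g (l +ℕ t) l))
      + Σ (suc n ∸ suc n) (λ t → g (suc n +ℕ t) (suc n)) ∎
    where
    column : ℕ → Carrier
    column l = Σ (n ∸ l) (λ t → g (l +ℕ t) l)
    longer-column : ∀ l → l ≤ n →
      column l + g (suc n) l ≈ Σ (suc n ∸ l) (λ t → g (l +ℕ t) l)
    longer-column l l≤n = begin
      column l + g (suc n) l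
        ≈⟨ +-congˡ (reflexive (≡.cong (λ i → g i l)
             (≡.trans (≡.cong suc (≡.sym (ℕₚ.m+[n∸m]≡n l≤n))) (≡.sym (ℕₚ.+-suc l (n ∸ l)))))) ⟩
      Σ (suc (n ∸ l)) (λ t → g (l +ℕ t) l)
        ≈⟨ Σ-≡ _ (ℕₚ.+-∸-assoc 1 l≤n) ⟨
      Σ (suc n ∸ l) (λ t → g (l +ℕ t) l) ∎
    last-column : Σ (suc n ∸ suc n) (λ t → g (suc n +ℕ t) (suc n)) ≈ g (suc n) (suc n)
    last-column = trans (Σ-≡ _ (ℕₚ.n∸n≡0 n))
                        (reflexive (≡.cong (λ i → g i (suc n)) (ℕₚ.+-identityʳ (suc n))))

  ι-+ : ∀ a b → ι (a +ℕ b) ≈ ι a + ι b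
  ι-+ zero    b = sym (+-identityˡ _)
  ι-+ (suc a) b = trans (+-congˡ (ι-+ a b)) (sym (+-assoc _ _ _))

  ι-* : ∀ a b → ι (a *ℕ b) ≈ ι a * ι b
  ι-* zero    b = sym (zeroˡ _)
  ι-* (suc a) b = begin
    ι (b +ℕ a *ℕ b)       ≈⟨ trans (ι-+ b (a *ℕ b)) (+-congˡ (ι-* a b)) ⟩
    ι b + ι a * ι b       ≈⟨ +-congʳ (*-identityˡ _) ⟨
    1# * ι b + ι a * ι b  ≈⟨ distribʳ _ _ _ ⟨
    (1# + ι a) * ι b      ∎

  ι-1* : ∀ x → ι 1 * x ≈ x
  ι-1* x = trans (*-congʳ (+-identityʳ 1#)) (*-identityˡ x)

  C-vanish : ∀ {n k} → n < k → ι (n C k) ≈ 0#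
  C-vanish n<k = reflexive (≡.cong ι (k>n⇒nCk≡0 n<k))

  C-pascal : ∀ n k → ι (suc n C suc k) ≈ ι (n C k) + ι (n C suc k)
  C-pascal n k = trans (reflexive (≡.cong ι (≡.sym (nCk+nC[k+1]≡[n+1]C[k+1] n k))))
                       (ι-+ (n C k) (n C suc k))

  -- binomial transform: T a is the sequence whose EGF is e^t times that of a
  T : (ℕ → Carrier) → ℕ → Carrier
  T a n = Σ n (λ i → ι (n C i) * a i)

  -- Pascal's rule for the binomial transform: (1+x)^(k+1) = (1+x)^k + x(1+x)^k
  T-pascal : ∀ a k → T a (suc k) ≈ T a k + T (a ∘ suc) k
  T-pascal a k = begin
    T a (suc k)
      ≈⟨ Σ-shift k _ ⟩
    ι 1 * a 0 + Σ k (λ j → ι (suc k C suc j) * a (suc j))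
      ≈⟨ +-cong (ι-1* (a 0)) (Σ-cong k (λ j _ → trans (*-congʳ (C-pascal k j)) (distribʳ _ _ _))) ⟩
    a 0 + Σ k (λ j → ι (k C j) * a (suc j) + ι (k C suc j) * a (suc j))
      ≈⟨ +-congˡ (Σ-+ k _ _) ⟩
    a 0 + (T (a ∘ suc) k + Σ k (λ j → ι (k C suc j) * a (suc j)))
      ≈⟨ solve 3 (λ x y z → x :+ (y :+ z) := (x :+ z) :+ y) refl (a 0) (T (a ∘ suc) k) _ ⟩
    (a 0 + Σ k (λ j → ι (k C suc j) * a (suc j))) + T (a ∘ suc) k
      ≈⟨ +-congʳ (trans (Σ-shift k (λ j → ι (k C j) * a j)) (+-congʳ (ι-1* (a 0)))) ⟨
    Σ (suc k) (λ j → ι (k C j) * a j) + T (a ∘ suc) k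
      ≈⟨ +-congʳ (Σ-ext _ (ℕₚ.≤⇒≤′ (ℕₚ.n≤1+n k)) (λ i k<i → trans (*-congʳ (C-vanish k<i)) (zeroˡ _))) ⟨
    T a k + T (a ∘ suc) k ∎

  Δ : ℕ → (ℕ → Carrier) → ℕ → Carrier
  Δ m a k = Σ m (λ l → ι (m C l) * sg (m ∸ l) * a (l +ℕ k))

  Δ-cong : ∀ m {a b} k → (∀ n → a n ≈ b n) → Δ m a k ≈ Δ m b k
  Δ-cong m k a≈b = Σ-cong m (λ l _ → *-congˡ (a≈b (l +ℕ k)))

  Δ-+ : ∀ m a b k → Δ m (λ n → a n + b n) k ≈ Δ m a k + Δ m b k
  Δ-+ m a b k = trans (Σ-cong m (λ l _ → distribˡ _ _ _)) (Σ-+ m _ _)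

  Δ-scale : ∀ m x a k → Δ m (λ n → x * a n) k ≈ x * Δ m a k
  Δ-scale m x a k = trans (Σ-cong m (λ l _ → solve 3 (λ w x y → w :* (x :* y) := x :* (w :* y))
                                                      refl (ι (m C l) * sg (m ∸ l)) x (a (l +ℕ k))))
                          (Σ-* m x _)

  Δ-as-T : ∀ m a k → Δ m a k ≈ T (λ l → sg (m ∸ l) * a (l +ℕ k)) m
  Δ-as-T m a k = Σ-cong m (λ l _ → *-assoc _ _ _)

  Δ-step : ∀ m a k → Δ (suc m) a k ≈ Δ m a (suc k) + - Δ m a k
  Δ-step m a k = begin
    Δ (suc m) a k
      ≈⟨ Δ-as-T (suc m) a k ⟩
    T f (suc m)
      ≈⟨ T-pascal f m ⟩
    T f m + T (f ∘ suc) m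
      ≈⟨ +-cong lower-terms upper-terms ⟩
    - Δ m a k + Δ m a (suc k)
      ≈⟨ +-comm _ _ ⟩
    Δ m a (suc k) + - Δ m a k ∎
    where
    f : ℕ → Carrier
    f l = sg (suc m ∸ l) * a (l +ℕ k)
    lower-terms : T f m ≈ - Δ m a k
    lower-terms = begin
      T f m
        ≈⟨ Σ-cong m (λ l l≤m → *-congˡ (*-congʳ (reflexive (≡.cong sg (ℕₚ.+-∸-assoc 1 l≤m))))) ⟩
      Σ m (λ l → ι (m C l) * (- sg (m ∸ l) * a (l +ℕ k)))
        ≈⟨ Σ-cong m (λ l _ → trans (*-congˡ (sym (-‿distribˡ-* _ _))) (sym (-‿distribʳ-* _ _))) ⟩
      Σ m (λ l → - (ι (m C l) * (sg (m ∸ l) * a (l +ℕ k))))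
        ≈⟨ Σ-neg m _ ⟩
      - T (λ l → sg (m ∸ l) * a (l +ℕ k)) m
        ≈⟨ -‿cong (Δ-as-T m a k) ⟨
      - Δ m a k ∎
    upper-terms : T (f ∘ suc) m ≈ Δ m a (suc k)
    upper-terms = begin
      T (f ∘ suc) m
        ≈⟨ Σ-cong m (λ l _ → *-congˡ (*-congˡ (reflexive (≡.cong a (≡.sym (ℕₚ.+-suc l k)))))) ⟩
      T (λ l → sg (m ∸ l) * a (l +ℕ suc k)) m
        ≈⟨ Δ-as-T m a (suc k) ⟨
      Δ m a (suc k) ∎

  Δ-T : ∀ a m k → Δ m (T a) k ≈ T (λ j → a (j +ℕ m)) k
  Δ-T a zero    k = begin
    ι 1 * 1# * T a k  ≈⟨ trans (*-congʳ (*-identityʳ _)) (ι-1* _) ⟩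
    T a k             ≈⟨ Σ-cong k (λ j _ → *-congˡ (reflexive (≡.cong a (≡.sym (ℕₚ.+-identityʳ j))))) ⟩
    T (λ j → a (j +ℕ 0)) k ∎
  Δ-T a (suc m) k = begin
    Δ (suc m) (T a) k
      ≈⟨ Δ-step m (T a) k ⟩
    Δ m (T a) (suc k) + - Δ m (T a) k
      ≈⟨ +-cong (Δ-T a m (suc k)) (-‿cong (Δ-T a m k)) ⟩
    T aₘ (suc k) + - T aₘ k
      ≈⟨ +-congʳ (T-pascal aₘ k) ⟩
    T aₘ k + T (aₘ ∘ suc) k + - T aₘ k
      ≈⟨ xyx⁻¹≈y _ _ ⟩
    T (aₘ ∘ suc) k
      ≈⟨ Σ-cong k (λ j _ → *-congˡ (reflexive (≡.cong a (≡.sym (ℕₚ.+-suc j m))))) ⟩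
    T (λ j → a (j +ℕ suc m)) k ∎
    where
    aₘ : ℕ → Carrier
    aₘ j = a (j +ℕ m)

  -- binomial convolution: the EGF of a ⋆ b is the product of those of a and b
  _⋆_ : (ℕ → Carrier) → (ℕ → Carrier) → ℕ → Carrier
  (a ⋆ b) n = Σ n (λ l → ι (n C l) * a (n ∸ l) * b l)

  ⋆-cong : ∀ {a a′} b n → (∀ i → a i ≈ a′ i) → (a ⋆ b) n ≈ (a′ ⋆ b) n
  ⋆-cong b n a≈a′ = Σ-cong n (λ l _ → *-congʳ (*-congˡ (a≈a′ (n ∸ l))))

  ⋆-+ : ∀ a a′ b n → ((λ i → a i + a′ i) ⋆ b) n ≈ (a ⋆ b) n + (a′ ⋆ b) n
  ⋆-+ a a′ b n = trans (Σ-cong n (λ l _ → solve 4 (λ c x y z → c :* (x :+ y) :* z := c :* x :* z :+ c :* y :* z)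
                                                   refl (ι (n C l)) (a (n ∸ l)) (a′ (n ∸ l)) (b l)))
                       (Σ-+ n _ _)

  ⋆-scale : ∀ x a b n → ((λ i → x * a i) ⋆ b) n ≈ x * (a ⋆ b) n
  ⋆-scale x a b n = trans (Σ-cong n (λ l _ → solve 4 (λ c x y z → c :* (x :* y) :* z := x :* (c :* y :* z))
                                                      refl (ι (n C l)) x (a (n ∸ l)) (b l)))
                          (Σ-* n x _)

  δ-⋆ : ∀ b n → (δ ⋆ b) n ≈ b n
  δ-⋆ b n = begin
    (δ ⋆ b) n                     ≈⟨ Σ-top n _ off-diagonal ⟩
    ι (n C n) * δ (n ∸ n) * b n   ≈⟨ reflexive (≡.cong₂ (λ c d → ι c * δ d * b n) (nCn≡1 n) (ℕₚ.n∸n≡0 n)) ⟩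
    ι 1 * 1# * b n                ≈⟨ trans (*-congʳ (*-identityʳ _)) (ι-1* _) ⟩
    b n                           ∎
    where
    off-diagonal : ∀ l → l < n → ι (n C l) * δ (n ∸ l) * b l ≈ 0#
    off-diagonal l (s≤s l≤n-1) =
      trans (*-congʳ (trans (*-congˡ (reflexive (≡.cong δ (ℕₚ.+-∸-assoc 1 l≤n-1)))) (zeroʳ _)))
            (zeroˡ _)

  -- Step (1): T (a ⋆ b) = (T a) ⋆ b, i.e. e^t (A B) = (e^t A) B for EGFs.
  T-⋆ : ∀ a b n → T (a ⋆ b) n ≈ (T a ⋆ b) n
  T-⋆ a b n = begin
    Σ n (λ i → ι (n C i) * (a ⋆ b) i)
      ≈⟨ Σ-cong n (λ i _ → sym (Σ-* i _ _)) ⟩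
    Σ n (λ i → Σ i (g i))
      ≈⟨ Σ-triangle n g ⟩
    Σ n (λ l → Σ (n ∸ l) (λ t → g (l +ℕ t) l))
      ≈⟨ Σ-cong n (λ l l≤n → Σ-cong (n ∸ l) (λ t t≤n∸l → regroup l t (bound l t l≤n t≤n∸l))) ⟩
    Σ n (λ l → Σ (n ∸ l) (λ t → ι (n C l) * b l * (ι ((n ∸ l) C t) * a t)))
      ≈⟨ Σ-cong n (λ l _ → Σ-* (n ∸ l) _ _) ⟩
    Σ n (λ l → ι (n C l) * b l * T a (n ∸ l))
      ≈⟨ Σ-cong n (λ l _ → solve 3 (λ c y z → c :* y :* z := c :* z :* y) refl (ι (n C l)) (b l) _) ⟩
    (T a ⋆ b) n ∎
    where
    g : ℕ → ℕ → Carrier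
    g i l = ι (n C i) * (ι (i C l) * a (i ∸ l) * b l)
    bound : ∀ l t → l ≤ n → t ≤ n ∸ l → l +ℕ t ≤ n
    bound l t l≤n t≤n∸l = ℕₚ.≤-trans (ℕₚ.+-monoʳ-≤ l t≤n∸l) (ℕₚ.≤-reflexive (ℕₚ.m+[n∸m]≡n l≤n))
    -- each term is rewritten with C(n,l+t) C(l+t,l) = C(n,l) C(n-l,t)
    regroup : ∀ l t → l +ℕ t ≤ n → g (l +ℕ t) l ≈ ι (n C l) * b l * (ι ((n ∸ l) C t) * a t)
    regroup l t l+t≤n = begin
      ι (n C (l +ℕ t)) * (ι ((l +ℕ t) C l) * a ((l +ℕ t) ∸ l) * b l)
        ≈⟨ *-congˡ (*-congʳ (*-congˡ (reflexive (≡.cong a (ℕₚ.m+n∸m≡n l t))))) ⟩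
      ι (n C (l +ℕ t)) * (ι ((l +ℕ t) C l) * a t * b l)
        ≈⟨ solve 4 (λ x y u v → x :* (y :* u :* v) := (x :* y) :* (v :* u))
                   refl (ι (n C (l +ℕ t))) (ι ((l +ℕ t) C l)) (a t) (b l) ⟩
      (ι (n C (l +ℕ t)) * ι ((l +ℕ t) C l)) * (b l * a t)
        ≈⟨ *-congʳ binomials ⟩
      (ι (n C l) * ι ((n ∸ l) C t)) * (b l * a t)
        ≈⟨ solve 4 (λ x y u v → (x :* y) :* (v :* u) := x :* v :* (y :* u))
                   refl (ι (n C l)) (ι ((n ∸ l) C t)) (a t) (b l) ⟩
      ι (n C l) * b l * (ι ((n ∸ l) C t) * a t) ∎
      where
      binomials : ι (n C (l +ℕ t)) * ι ((l +ℕ t) C l) ≈ ι (n C l) * ι ((n ∸ l) C t)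
      binomials = begin
        ι (n C (l +ℕ t)) * ι ((l +ℕ t) C l)   ≈⟨ ι-* (n C (l +ℕ t)) ((l +ℕ t) C l) ⟨
        ι ((n C (l +ℕ t)) *ℕ ((l +ℕ t) C l))  ≈⟨ reflexive (≡.cong ι (choose-twice n l t l+t≤n)) ⟩
        ι ((n C l) *ℕ ((n ∸ l) C t))          ≈⟨ ι-* (n C l) ((n ∸ l) C t) ⟩
        ι (n C l) * ι ((n ∸ l) C t)           ∎

  euler-square : ∀ q E → IsQEuler R q E → ∀ n → q * T (E ⋆ E) n + (E ⋆ E) n ≈ [2] R q * E n
  euler-square q E isEuler n = begin
    q * T (E ⋆ E) n + (E ⋆ E) n
      ≈⟨ +-congʳ (*-congˡ (T-⋆ E E n)) ⟩
    q * (T E ⋆ E) n + (E ⋆ E) n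
      ≈⟨ +-congʳ (⋆-scale q (T E) E n) ⟨
    ((λ i → q * T E i) ⋆ E) n + (E ⋆ E) n
      ≈⟨ ⋆-+ (λ i → q * T E i) E E n ⟨
    ((λ i → q * T E i + E i) ⋆ E) n
      ≈⟨ ⋆-cong E n isEuler ⟩
    ((λ i → [2] R q * δ i) ⋆ E) n
      ≈⟨ ⋆-scale ([2] R q) δ E n ⟩
    [2] R q * (δ ⋆ E) n
      ≈⟨ *-congˡ (δ-⋆ E n) ⟩
    [2] R q * E n ∎

  LHS-split : ∀ q F k m →
    Σ (k ⊔ m) (λ j → (q * ι (k C j) + sg j * ι (m C j)) * F ((k +ℕ m) ∸ j))
      ≈ q * T (λ i → F (i +ℕ m)) k + Δ m F k
  LHS-split q F k m = begin
    Σ (k ⊔ m) (λ j → (q * ι (k C j) + sg j * ι (m C j)) * F (n ∸ j))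
      ≈⟨ Σ-cong (k ⊔ m) (λ j _ → solve 5 (λ q x s y f → (q :* x :+ s :* y) :* f := q :* (x :* f) :+ s :* y :* f)
                                          refl q (ι (k C j)) (sg j) (ι (m C j)) (F (n ∸ j))) ⟩
    Σ (k ⊔ m) (λ j → q * up j + down j)
      ≈⟨ trans (Σ-+ (k ⊔ m) _ _) (+-congʳ (Σ-* (k ⊔ m) q up)) ⟩
    q * Σ (k ⊔ m) up + Σ (k ⊔ m) down
      ≈⟨ +-cong (*-congˡ (Σ-ext up (ℕₚ.≤⇒≤′ (ℕₚ.m≤m⊔n k m)) up-vanishes))
                (Σ-ext down (ℕₚ.≤⇒≤′ (ℕₚ.m≤n⊔m k m)) down-vanishes) ⟨
    q * Σ k up + Σ m down
      ≈⟨ +-cong (*-congˡ (Σ-reflect k up _ up-reflected)) (Σ-reflect m down _ down-reflected) ⟩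
    q * T (λ i → F (i +ℕ m)) k + Δ m F k ∎
    where
    n : ℕ
    n = k +ℕ m
    up down : ℕ → Carrier
    up   j = ι (k C j) * F (n ∸ j)
    down j = sg j * ι (m C j) * F (n ∸ j)

    up-vanishes : ∀ j → k < j → up j ≈ 0#
    up-vanishes j k<j = trans (*-congʳ (C-vanish k<j)) (zeroˡ _)
    down-vanishes : ∀ j → m < j → down j ≈ 0#
    down-vanishes j m<j = trans (*-congʳ (trans (*-congˡ (C-vanish m<j)) (zeroʳ _))) (zeroˡ _)

    up-reflected : ∀ i → i ≤ k → up (k ∸ i) ≈ ι (k C i) * F (i +ℕ m)
    up-reflected i i≤k = reflexive (≡.cong₂ (λ c d → ι c * F d)
      (≡.sym (nCk≡nC[n∸k] i≤k)) (reflect-index m i≤k))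
    down-reflected : ∀ i → i ≤ m → down (m ∸ i) ≈ ι (m C i) * sg (m ∸ i) * F (i +ℕ k)
    down-reflected i i≤m = begin
      sg (m ∸ i) * ι (m C (m ∸ i)) * F (n ∸ (m ∸ i))
        ≈⟨ *-congʳ (*-comm _ _) ⟩
      ι (m C (m ∸ i)) * sg (m ∸ i) * F (n ∸ (m ∸ i))
        ≈⟨ reflexive (≡.cong₂ (λ c d → ι c * sg (m ∸ i) * F d) (≡.sym (nCk≡nC[n∸k] i≤m))
             (≡.trans (≡.cong (_∸ (m ∸ i)) (ℕₚ.+-comm k m)) (reflect-index k i≤m))) ⟩
      ι (m C i) * sg (m ∸ i) * F (i +ℕ k) ∎

theorem4 : {c ℓ : Level} (R : CommutativeRing c ℓ) (q : CommutativeRing.Carrier R)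
    (E : ℕ → CommutativeRing.Carrier R) → IsQEuler R q E →
    (k m : ℕ) → CommutativeRing._≈_ R (LHS R q E k m) (RHS R q E k m)
theorem4 R q E isEuler k m = begin
  LHS R q E k m
    ≈⟨ LHS-split q F k m ⟩
  q * T (λ i → F (i +ℕ m)) k + Δ m F k
    ≈⟨ +-congʳ (*-congˡ (Δ-T F m k)) ⟨
  q * Δ m (T F) k + Δ m F k
    ≈⟨ +-congʳ (Δ-scale m q (T F) k) ⟨
  Δ m (λ n → q * T F n) k + Δ m F k
    ≈⟨ Δ-+ m (λ n → q * T F n) F k ⟨
  Δ m (λ n → q * T F n + F n) k
    ≈⟨ Δ-cong m k (euler-square q E isEuler) ⟩
  Δ m (λ n → [2] R q * E n) k
    ≈⟨ Δ-scale m ([2] R q) E k ⟩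
  RHS R q E k m ∎
  where
  open BinomialSums R
  open CommutativeRing R
  open import Relation.Binary.Reasoning.Setoid setoid
  open import Data.Nat.Base using () renaming (_+_ to _+ℕ_)
  F : ℕ → Carrier
  F = E ⋆ E
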